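{- Let $G=(V,E)$ be a temporal graph and consider a DFS-v2 traversal of $G$ from a source $s$ with starting time $t_s$. For any vertex $u\in V$ and any two temporal edges $e_i=(u,v_i,t_i)$ and $e_j=(u,v_j,t_j)$ of $E$, if $e_i$ is traversed before $e_j$ in the traversal, then $t_i\ge t_j$.
   Context: A temporal graph is $G=(V,E)$ with $V$ a finite vertex set and $E$ a finite set of temporal edges $(u,v,t)$, $u\neq v$, $t$ real; distinct temporal edges from $u$ to $v$ have distinct times. DFS-v2 from $s$ with starting time $t_s$: keep $\sigma(x)$ for every vertex, initially $\infty$; build a rooted tree $T$ of occurrences of vertices. Visit $s$: set $\sigma(s)=t_s$, create the root (an occurrence of $s$), make it current. Repeat: (a) let $u$ be the current occurrence's vertex and $E_u$ the set of not-yet-traversed edges $(u,v,t)\in E$ leaving $u$ with $\sigma(u)\le t$; if $E_u\neq\emptyset$, traverse an edge of $E_u$ of maximum time and go to (b); otherwise terminate if the current occurrence is the root, else backtrack to the parent occurrence and repeat (a). (b) After traversing $(u,v,t)$: if $\sigma(v)>t$, set $\sigma(v)=t$, create a new occurrence of $v$ as a child of the current occurrence, make it current, and go to (a); otherwise repeat (a). -}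

module Defs where

open import Level using (0ℓ)
open import Data.Nat using (ℕ)
open import Data.Fin using (Fin) renaming (_≟_ to _≟ᶠ_)
open import Data.Bool using (if_then_else_)
open import Data.List using (List; []; _∷_; _++_; [_])
open import Data.List.Membership.Propositional using (_∉_)
open import Data.Product using (_×_)
open import Data.Sum using (_⊎_)
open import Data.Empty using (⊥)
open import Data.Unit using (⊤)
open import Relation.Nullary using (¬_)
open import Relation.Nullary.Decidable using (⌊_⌋)
open import Relation.Binary.Bundles using (StrictTotalOrder)
open import Relation.Binary.PropositionalEquality using (_≡_; _≢_)
open import Relation.Binary.Construct.Closure.ReflexiveTransitive using (Star)

module Temporal (O : StrictTotalOrder 0ℓ 0ℓ 0ℓ) where

  open StrictTotalOrder O renaming (Carrier to Time)

  _≤ₜ_ : Time → Time → Set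
  a ≤ₜ b = a < b ⊎ a ≈ b

  -- A temporal graph with vertex set Fin n and edge set indexed by Fin m:
  -- edge k is (src k , dst k , time k).
  record TGraph (n m : ℕ) : Set where
    field
      src  : Fin m → Fin n
      dst  : Fin m → Fin n
      time : Fin m → Time
      loopless : ∀ k → src k ≢ dst k
      distinct : ∀ k k′ → k ≢ k′ → src k ≡ src k′ → dst k ≡ dst k′ →
                 ¬ (time k ≈ time k′)

  -- times extended with ∞ (the values of σ)
  data Time∞ : Set where
    fin : Time → Time∞
    ∞   : Time∞

  _≤σ_ : Time∞ → Time → Set
  fin a ≤σ t = a ≤ₜ t
  ∞     ≤σ t = ⊥

  _<σ_ : Time → Time∞ → Set
  t <σ fin a = t < a
  t <σ ∞     = ⊤

  module _ {n m : ℕ} (G : TGraph n m) where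
    open TGraph G

    -- State of DFS-v2: the values σ, the path of occurrences from the current
    -- occurrence up to the root (current vertex `cur`, ancestors `anc`, nearest
    -- first), and the list of traversed edges in chronological order.
    record State : Set where
      constructor state
      field
        σ     : Fin n → Time∞
        cur   : Fin n
        anc   : List (Fin n)
        trace : List (Fin m)
    open State public

    Eligible : State → Fin m → Set
    Eligible st k = src k ≡ cur st × k ∉ trace st × σ st (cur st) ≤σ time k

    update : (Fin n → Time∞) → Fin n → Time → (Fin n → Time∞)
    update σ v t x = if ⌊ x ≟ᶠ v ⌋ then fin t else σ x

    -- one step of DFS-v2 (step (a), combined with the following step (b))
    data Step : State → State → Set where
      traverse-new : ∀ {σ u anc tr} k →
        let st = state σ u anc tr in
        Eligible st k →
        (∀ k′ → Eligible st k′ → time k′ ≤ₜ time k) →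
        time k <σ σ (dst k) →
        Step st (state (update σ (dst k) (time k)) (dst k) (u ∷ anc) (tr ++ [ k ]))
      traverse-old : ∀ {σ u anc tr} k →
        let st = state σ u anc tr in
        Eligible st k →
        (∀ k′ → Eligible st k′ → time k′ ≤ₜ time k) →
        ¬ (time k <σ σ (dst k)) →
        Step st (state σ u anc (tr ++ [ k ]))
      backtrack : ∀ {σ u p anc tr} →
        (∀ k → ¬ Eligible (state σ u (p ∷ anc) tr) k) →
        Step (state σ u (p ∷ anc) tr) (state σ p anc tr)

    initial : Fin n → Time → State
    initial s ts = state (update (λ _ → ∞) s ts) s [] []

    Reachable : Fin n → Time → State → Set
    Reachable s ts = Star Step (initial s ts)

module Submission where

-- A DFS-v2 run only ever appends to its trace, and each appended edge k is
-- greedy: it has maximal time among the eligible edges of the current vertex u.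
-- Every other untraversed edge k′ of u is either eligible (so time k′ ≤ time k
-- by maximality) or fails σ(u) ≤ time k′, in which case time k′ < σ(u) ≤ time k.
-- Hence k *dominates* its source: every edge out of src k not yet traversed
-- has time at most time k (`greedy-dominates`).
--
-- We show that every reachable trace is `Sound`, i.e. both
--   * Saturated: each traversed edge still dominates its source, and
--   * Ordered:   any two traversed edges with a common source appear in
--                non-increasing order of time (an `AllPairs` property),
-- by checking that the invariant holds for the empty trace and is preserved by
-- appending a dominating edge (`sound-∷ʳ`), hence by every step of DFS-v2.

open import Defs
open import Level using (0ℓ)
open import Data.Nat using (ℕ)
open import Data.Fin using (Fin)
open import Data.List using (List; []; _∷_; _++_; [_])
open import Data.List.Membership.Propositional using (_∈_; _∉_)
open import Data.List.Membership.Propositional.Properties using (∈-++⁺ˡ; ∈-++⁻)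
open import Data.List.Relation.Unary.All as All using (All; []; _∷_)
open import Data.List.Relation.Unary.All.Properties using (++⁻ʳ)
open import Data.List.Relation.Unary.Any using (here)
open import Data.List.Relation.Unary.AllPairs using (AllPairs; []; _∷_)
import Data.List.Relation.Unary.AllPairs.Properties as AllPairsₚ
open import Data.Product using (_×_; _,_; proj₁)
open import Data.Sum using (inj₁; inj₂)
open import Relation.Binary.Bundles using (StrictTotalOrder)
open import Relation.Binary.Core using (Rel)
open import Relation.Binary.Definitions using (tri<; tri≈; tri>)
open import Relation.Binary.PropositionalEquality using (_≡_; refl; sym; trans; subst)
open import Relation.Binary.Construct.Closure.ReflexiveTransitive using (Star; ε; _◅_)
import Relation.Binary.Construct.StrictToNonStrict as NonStrict

AllPairs-later : ∀ {A : Set} {R : Rel A 0ℓ} xs a ys b zs →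
                 AllPairs R (xs ++ a ∷ ys ++ b ∷ zs) → R a b
AllPairs-later []       a ys b zs (a-before ∷ _) = All.head (++⁻ʳ ys a-before)
AllPairs-later (_ ∷ xs) a ys b zs (_ ∷ rest)      = AllPairs-later xs a ys b zs rest

module _ (O : StrictTotalOrder 0ℓ 0ℓ 0ℓ) where
  open StrictTotalOrder O renaming (Carrier to Time; trans to <-trans)
  open Temporal O

  -- If σ ≤ b, then a ≤ b follows from the implication σ ≤ a ⇒ a ≤ b:
  -- when σ ≤ a fails, a lies strictly below σ and hence below b.
  below-threshold : ∀ (σ : Time∞) {a b} → σ ≤σ b → (σ ≤σ a → a ≤ₜ b) → a ≤ₜ b
  below-threshold (fin c) {a} c≤b bound with compare c a
  ... | tri< c<a _ _ = bound (inj₁ c<a)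
  ... | tri≈ _ c≈a _ = bound (inj₂ c≈a)
  ... | tri> _ _ a<c = inj₁ (NonStrict.<-≤-trans _≈_ _<_ <-trans <-respʳ-≈ a<c c≤b)
  below-threshold ∞ () _

  module _ {n m : ℕ} (G : TGraph n m) where
    open TGraph G

    Dominates : List (Fin m) → Fin m → Set
    Dominates tr k = ∀ k′ → src k′ ≡ src k → k′ ∉ tr → time k′ ≤ₜ time k

    greedy-dominates : ∀ {st k} → Eligible G st k →
                       (∀ k′ → Eligible G st k′ → time k′ ≤ₜ time k) →
                       Dominates (trace st) k
    greedy-dominates {st} (src-k , _ , σ≤k) maximal k′ src-k′ k′∉ =
      below-threshold (σ st (cur st)) σ≤k
        (λ σ≤k′ → maximal k′ (trans src-k′ src-k , k′∉ , σ≤k′))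

    InOrder : Fin m → Fin m → Set
    InOrder a b = src a ≡ src b → time b ≤ₜ time a

    -- The invariant on traces: pairwise ordered, and every traversed edge still
    -- dominates its source (needed so that appending an edge keeps it ordered).
    Ordered Saturated Sound : List (Fin m) → Set
    Ordered tr   = AllPairs InOrder tr
    Saturated tr = ∀ {a} → a ∈ tr → Dominates tr a
    Sound tr     = Ordered tr × Saturated tr

    sound-[] : Sound []
    sound-[] = [] , λ ()

    sound-∷ʳ : ∀ {tr k} → k ∉ tr → Dominates tr k → Sound tr → Sound (tr ++ [ k ])
    sound-∷ʳ {tr} {k} k∉ k-dominates (ordered , saturated) =
      AllPairsₚ.++⁺ ordered (All.[] ∷ []) (All.tabulate before-k) , saturated′
      where
      before-k : ∀ {a} → a ∈ tr → All (InOrder a) [ k ]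
      before-k a∈ = (λ src-a≡src-k → saturated a∈ k (sym src-a≡src-k) k∉) ∷ []

      saturated′ : Saturated (tr ++ [ k ])
      saturated′ a∈ k′ src-k′ k′∉ with ∈-++⁻ tr a∈
      ... | inj₁ a∈tr       = saturated a∈tr k′ src-k′ (λ k′∈ → k′∉ (∈-++⁺ˡ k′∈))
      ... | inj₂ (here refl) = k-dominates k′ src-k′ (λ k′∈ → k′∉ (∈-++⁺ˡ k′∈))

    step-sound : ∀ {st st′} → Step G st st′ → Sound (trace st) → Sound (trace st′)
    step-sound (traverse-new {σ} {u} {anc} {tr} k eligible@(_ , k∉ , _) maximal _) =
      sound-∷ʳ k∉ (greedy-dominates {state σ u anc tr} eligible maximal)
    step-sound (traverse-old {σ} {u} {anc} {tr} k eligible@(_ , k∉ , _) maximal _) =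
      sound-∷ʳ k∉ (greedy-dominates {state σ u anc tr} eligible maximal)
    step-sound (backtrack _) sound = sound

    run-sound : ∀ {st st′} → Star (Step G) st st′ → Sound (trace st) → Sound (trace st′)
    run-sound ε          sound = sound
    run-sound (step ◅ r) sound = run-sound r (step-sound step sound)

    reachable-ordered : ∀ {s ts st} → Reachable G s ts st → Ordered (trace st)
    reachable-ordered run = proj₁ (run-sound run sound-[])

lemma7 : (O : StrictTotalOrder 0ℓ 0ℓ 0ℓ) → {n m : ℕ} → (G : Temporal.TGraph O n m) →
         (s : Fin n) → (ts : StrictTotalOrder.Carrier O) →
         (st : Temporal.State O G) → Temporal.Reachable O G s ts st →
         (ei ej : Fin m) → (xs ys zs : List (Fin m)) →
         Temporal.State.trace {O = O} {G = G} st ≡ xs ++ ei ∷ ys ++ ej ∷ zs →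
         Temporal.TGraph.src G ei ≡ Temporal.TGraph.src G ej →
         Temporal._≤ₜ_ O (Temporal.TGraph.time G ej) (Temporal.TGraph.time G ei)
lemma7 O G s ts st run ei ej xs ys zs trace≡ =
  AllPairs-later xs ei ys ej zs
    (subst (AllPairs (InOrder O G)) trace≡ (reachable-ordered O G run))
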